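{- Let $\Gamma$ and $\Delta$ be finite sets of $\mathcal{P}$-formulas and let $\mathit{Var}(\Gamma\cup\Delta)$ be the set of propositional constants appearing in $\Gamma$ or $\Delta$. Then $\Gamma \models^{\{\mathbf{b}\}}_{\mathcal{P}} \Delta$ holds if and only if the sequent $\emptyset ; \Gamma \Rightarrow \Delta ; \mathit{Var}(\Gamma \cup \Delta)$ is provable in the calculus $\mathsf{ME}_\mathcal{P}$.
   Context: The three-valued logic $\mathcal{P}$: truth values $\mathbf{f}<\mathbf{b}<\mathbf{t}$, designated values $\{\mathbf{b},\mathbf{t}\}$; formulas are built from a fixed countably infinite set $\mathcal{C}$ of propositional constants and the logical constant $\bot$ using $\neg,\land,\supset$. For an interpretation $I:\mathcal{C}\to\{\mathbf{f},\mathbf{b},\mathbf{t}\}$: $v^I(p)=I(p)$; $v^I(\bot)=\mathbf{f}$; $v^I(\neg\varphi)$ is $\mathbf{t},\mathbf{b},\mathbf{f}$ when $v^I(\varphi)$ is $\mathbf{f},\mathbf{b},\mathbf{t}$ respectively; $v^I(\varphi\land\psi)=\min(v^I(\varphi),v^I(\psi))$; $v^I(\varphi\supset\psi)=v^I(\psi)$ if $v^I(\varphi)\in\{\mathbf{b},\mathbf{t}\}$ and $\mathbf{t}$ otherwise. $I$ models $\varphi$ if $v^I(\varphi)\in\{\mathbf{b},\mathbf{t}\}$. A model $I$ of $\Gamma$ is minimally inconsistent if no model $J$ of $\Gamma$ has $\{p\in\mathcal{C}\mid J(p)=\mathbf{b}\}\subsetneq\{p\in\mathcal{C}\mid I(p)=\mathbf{b}\}$.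 $\Gamma\models^{\{\mathbf{b}\}}_{\mathcal{P}}\Delta$ iff every minimally inconsistent model of $\Gamma$ models some $\varphi\in\Delta$. Let $\nabla$ be the unary connective with $v(\nabla\varphi)=\mathbf{t}$ if $v(\varphi)\ne\mathbf{b}$ and $\mathbf{f}$ otherwise; $\nabla\Pi=\{\nabla p\mid p\in\Pi\}$. Sequents $\Gamma_1\mid\Gamma_2\mid\Gamma_3$ and anti-sequents $\Gamma_1\nmid\Gamma_2\nmid\Gamma_3$ are triples of finite sets of $\mathcal{P}$-formulas (components corresponding to $\mathbf{f},\mathbf{b},\mathbf{t}$); "$\Gamma,\varphi$" means $\Gamma\cup\{\varphi\}$. Calculus $\mathsf{S}_\mathcal{P}$. Axioms: $\Gamma_1,\varphi\mid\Gamma_2,\varphi\mid\Gamma_3,\varphi$ and $\Gamma_1,\bot\mid\Gamma_2\mid\Gamma_3$. Rules (premisses $\Rightarrow$ conclusion): $(\neg:\mathbf{f})$ $\Gamma\mid\Delta\mid\Pi,\varphi \Rightarrow \Gamma,\neg\varphi\mid\Delta\mid\Pi$; $(\neg:\mathbf{b})$ $\Gamma\mid\Delta,\varphi\mid\Pi\Rightarrow\Gamma\mid\Delta,\neg\varphi\mid\Pi$; $(\neg:\mathbf{t})$ $\Gamma,\varphi\mid\Delta\mid\Pi\Rightarrow\Gamma\mid\Delta\mid\Pi,\neg\varphi$; $(\land:\mathbf{f})$ $\Gamma,\varphi,\psi\mid\Delta\mid\Pi\Rightarrow\Gamma,\varphi\land\psi\mid\Delta\mid\Pi$; $(\land:\mathbf{t})$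 $\Gamma\mid\Delta\mid\Pi,\varphi$ and $\Gamma\mid\Delta\mid\Pi,\psi\Rightarrow\Gamma\mid\Delta\mid\Pi,\varphi\land\psi$; $(\land:\mathbf{b})$ $\Gamma\mid\Delta,\varphi,\psi\mid\Pi$ and $\Gamma\mid\Delta,\varphi\mid\Pi,\varphi$ and $\Gamma\mid\Delta,\psi\mid\Pi,\psi\Rightarrow\Gamma\mid\Delta,\varphi\land\psi\mid\Pi$; $(\supset:\mathbf{f})$ $\Gamma\mid\Delta,\varphi\mid\Pi,\varphi$ and $\Gamma,\psi\mid\Delta\mid\Pi\Rightarrow\Gamma,\varphi\supset\psi\mid\Delta\mid\Pi$; $(\supset:\mathbf{b})$ $\Gamma\mid\Delta,\varphi\mid\Pi,\varphi$ and $\Gamma\mid\Delta,\psi\mid\Pi\Rightarrow\Gamma\mid\Delta,\varphi\supset\psi\mid\Pi$; $(\supset:\mathbf{t})$ $\Gamma,\varphi\mid\Delta\mid\Pi,\psi\Rightarrow\Gamma\mid\Delta\mid\Pi,\varphi\supset\psi$; weakening: from $\Gamma\mid\Delta\mid\Pi$ infer the sequent obtained by adding any formula to any one component. Calculus $\mathsf{R}_\mathcal{P}$. Axioms: $\Gamma_1\nmid\Gamma_2\nmid\Gamma_3$ where the $\Gamma_i$ are sets of propositional constants and $\bot$, with $\Gamma_1\cap\Gamma_2\cap\Gamma_3=\emptyset$ and $\bot\notin\Gamma_1$. Rules (single premiss): $(\neg:\mathbf{f}),(\neg:\mathbf{b}),(\neg:\mathbf{t})$ as in $\mathsf{S}_\mathcal{P}$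 with $\nmid$ in place of $\mid$; $(\land:\mathbf{f})$ $\Gamma,\varphi,\psi\nmid\Delta\nmid\Pi\Rightarrow\Gamma,\varphi\land\psi\nmid\Delta\nmid\Pi$; $(\land:\mathbf{b}^1)$ $\Gamma\nmid\Delta,\varphi,\psi\nmid\Pi$, $(\land:\mathbf{b}^2)$ $\Gamma\nmid\Delta,\varphi\nmid\Pi,\varphi$, $(\land:\mathbf{b}^3)$ $\Gamma\nmid\Delta,\psi\nmid\Pi,\psi$, each $\Rightarrow\Gamma\nmid\Delta,\varphi\land\psi\nmid\Pi$; $(\land:\mathbf{t}^1)$ $\Gamma\nmid\Delta\nmid\Pi,\varphi$, $(\land:\mathbf{t}^2)$ $\Gamma\nmid\Delta\nmid\Pi,\psi$, each $\Rightarrow\Gamma\nmid\Delta\nmid\Pi,\varphi\land\psi$; $(\supset:\mathbf{f}^1)$ $\Gamma\nmid\Delta,\varphi\nmid\Pi,\varphi$, $(\supset:\mathbf{f}^2)$ $\Gamma,\psi\nmid\Delta\nmid\Pi$, each $\Rightarrow\Gamma,\varphi\supset\psi\nmid\Delta\nmid\Pi$; $(\supset:\mathbf{b}^1)$ $\Gamma\nmid\Delta,\varphi\nmid\Pi,\varphi$, $(\supset:\mathbf{b}^2)$ $\Gamma\nmid\Delta,\psi\nmid\Pi$, each $\Rightarrow\Gamma\nmid\Delta,\varphi\supset\psi\nmid\Pi$; $(\supset:\mathbf{t})$ $\Gamma,\varphi\nmid\Delta\nmid\Pi,\psi\Rightarrow\Gamma\nmid\Delta\nmid\Pi,\varphi\supset\psi$.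 Calculus $\mathsf{ME}_\mathcal{P}$: $\mathsf{S}_\mathcal{P}$, $\mathsf{R}_\mathcal{P}$, and rules for sequents $\Sigma;\Gamma\Rightarrow\Delta;\Theta$ ($\Sigma,\Theta$ finite subsets of $\mathcal{C}$, $\Gamma$ a finite set of $\mathcal{P}$-formulas and formulas $\nabla p$, $\Delta$ a finite set of $\mathcal{P}$-formulas). In $(m_1')$, $(m_2')$ below, $\Gamma$ is a set of $\mathcal{P}$-formulas and $\Pi$ a set of propositional constants. $(m_1')$: from the $\mathsf{R}_\mathcal{P}$-provable anti-sequent $\Gamma\nmid\Theta\cup\Pi\cup\{q\}\nmid\emptyset$ infer $\{q\}\cup\Sigma;\Gamma\cup\nabla\Pi\Rightarrow\Delta;\Theta$. $(m_2')$: from the $\mathsf{S}_\mathcal{P}$-provable sequent $\Sigma\cup\Gamma\mid\Delta\cup\Pi\mid\Delta\cup\Sigma$ infer $\Sigma;\Gamma\cup\nabla\Pi\Rightarrow\Delta;\Theta$. $(m_3)$: from $\{q\}\cup\Sigma;\Gamma\Rightarrow\Delta;\Theta$ and $\Sigma;\Gamma\cup\{\nabla q\}\Rightarrow\Delta;\Theta$ infer $\Sigma;\Gamma\Rightarrow\Delta;\Theta\cup\{q\}$. -}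

module Defs where

open import Data.Nat using (ℕ)
open import Data.List using (List; []; _∷_; _++_; map; concatMap; [_])
open import Data.List.Membership.Propositional using (_∈_)
open import Data.List.Relation.Unary.All using (All)
open import Data.List.Relation.Unary.Any using (Any)
open import Data.Product using (_×_; ∃; Σ)
open import Data.Empty using (⊥)
open import Relation.Nullary using (¬_)
open import Relation.Binary.PropositionalEquality using (_≡_; _≢_)

infixr 8 _∧'_
infixr 7 _⊃_

data Fm : Set where
  atom : ℕ → Fm
  bot  : Fm
  neg  : Fm → Fm
  _∧'_ : Fm → Fm → Fm
  _⊃_  : Fm → Fm → Fm

data V : Set where
  𝐟 𝐛 𝐭 : V

data Designated : V → Set where
  des-b : Designated 𝐛
  des-t : Designated 𝐭

Interp : Set
Interp = ℕ → V

negV : V → V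
negV 𝐟 = 𝐭
negV 𝐛 = 𝐛
negV 𝐭 = 𝐟

minV : V → V → V
minV 𝐟 _ = 𝐟
minV 𝐛 𝐟 = 𝐟
minV 𝐛 _ = 𝐛
minV 𝐭 y = y

impV : V → V → V
impV 𝐟 _ = 𝐭
impV 𝐛 y = y
impV 𝐭 y = y

val : Interp → Fm → V
val I (atom p) = I p
val I bot      = 𝐟
val I (neg φ)  = negV (val I φ)
val I (φ ∧' ψ) = minV (val I φ) (val I ψ)
val I (φ ⊃ ψ)  = impV (val I φ) (val I ψ)

Models : Interp → Fm → Set
Models I φ = Designated (val I φ)

ModelOf : Interp → List Fm → Set
ModelOf I Γ = All (Models I) Γ

InconsStrictSub : Interp → Interp → Set
InconsStrictSub J I =
  (∀ p → J p ≡ 𝐛 → I p ≡ 𝐛) × ∃ λ p → I p ≡ 𝐛 × J p ≢ 𝐛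

MinInconsModel : List Fm → Interp → Set
MinInconsModel Γ I =
  ModelOf I Γ × ¬ (∃ λ J → ModelOf J Γ × InconsStrictSub J I)

_⊨b_ : List Fm → List Fm → Set
Γ ⊨b Δ = ∀ I → MinInconsModel Γ I → Any (Models I) Δ

-- Finite sets represented by lists, up to having the same elements.

SameSet : {A : Set} → List A → List A → Set
SameSet {A} X Y = ∀ (x : A) → (x ∈ X → x ∈ Y) × (x ∈ Y → x ∈ X)

data SP : List Fm → List Fm → List Fm → Set where
  ax      : ∀ {Γ₁ Γ₂ Γ₃} φ → SP (φ ∷ Γ₁) (φ ∷ Γ₂) (φ ∷ Γ₃)
  ax⊥     : ∀ {Γ₁ Γ₂ Γ₃} → SP (bot ∷ Γ₁) Γ₂ Γ₃
  ¬f      : ∀ {Γ Δ Π φ} → SP Γ Δ (φ ∷ Π) → SP (neg φ ∷ Γ) Δ Π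
  ¬b      : ∀ {Γ Δ Π φ} → SP Γ (φ ∷ Δ) Π → SP Γ (neg φ ∷ Δ) Π
  ¬t      : ∀ {Γ Δ Π φ} → SP (φ ∷ Γ) Δ Π → SP Γ Δ (neg φ ∷ Π)
  ∧f      : ∀ {Γ Δ Π φ ψ} → SP (φ ∷ ψ ∷ Γ) Δ Π → SP (φ ∧' ψ ∷ Γ) Δ Π
  ∧t      : ∀ {Γ Δ Π φ ψ} → SP Γ Δ (φ ∷ Π) → SP Γ Δ (ψ ∷ Π)
          → SP Γ Δ (φ ∧' ψ ∷ Π)
  ∧b      : ∀ {Γ Δ Π φ ψ} → SP Γ (φ ∷ ψ ∷ Δ) Π → SP Γ (φ ∷ Δ) (φ ∷ Π)
          → SP Γ (ψ ∷ Δ) (ψ ∷ Π) → SP Γ (φ ∧' ψ ∷ Δ) Π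
  ⊃f      : ∀ {Γ Δ Π φ ψ} → SP Γ (φ ∷ Δ) (φ ∷ Π) → SP (ψ ∷ Γ) Δ Π
          → SP (φ ⊃ ψ ∷ Γ) Δ Π
  ⊃b      : ∀ {Γ Δ Π φ ψ} → SP Γ (φ ∷ Δ) (φ ∷ Π) → SP Γ (ψ ∷ Δ) Π
          → SP Γ (φ ⊃ ψ ∷ Δ) Π
  ⊃t      : ∀ {Γ Δ Π φ ψ} → SP (φ ∷ Γ) Δ (ψ ∷ Π) → SP Γ Δ (φ ⊃ ψ ∷ Π)
  weak₁   : ∀ {Γ Δ Π} φ → SP Γ Δ Π → SP (φ ∷ Γ) Δ Π
  weak₂   : ∀ {Γ Δ Π} φ → SP Γ Δ Π → SP Γ (φ ∷ Δ) Π
  weak₃   : ∀ {Γ Δ Π} φ → SP Γ Δ Π → SP Γ Δ (φ ∷ Π)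
  -- sequents are triples of *sets*: lists with the same elements denote
  -- the same sequent
  sets    : ∀ {Γ Δ Π Γ' Δ' Π'} → SameSet Γ Γ' → SameSet Δ Δ' → SameSet Π Π'
          → SP Γ Δ Π → SP Γ' Δ' Π'

data AtomOrBot : Fm → Set where
  isAtom : ∀ p → AtomOrBot (atom p)
  isBot  : AtomOrBot bot

data RP : List Fm → List Fm → List Fm → Set where
  ax      : ∀ {Γ₁ Γ₂ Γ₃} → All AtomOrBot Γ₁ → All AtomOrBot Γ₂ → All AtomOrBot Γ₃
          → (∀ φ → φ ∈ Γ₁ → φ ∈ Γ₂ → φ ∈ Γ₃ → ⊥)
          → ¬ (bot ∈ Γ₁)
          → RP Γ₁ Γ₂ Γ₃
  ¬f      : ∀ {Γ Δ Π φ} → RP Γ Δ (φ ∷ Π) → RP (neg φ ∷ Γ) Δ Π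
  ¬b      : ∀ {Γ Δ Π φ} → RP Γ (φ ∷ Δ) Π → RP Γ (neg φ ∷ Δ) Π
  ¬t      : ∀ {Γ Δ Π φ} → RP (φ ∷ Γ) Δ Π → RP Γ Δ (neg φ ∷ Π)
  ∧f      : ∀ {Γ Δ Π φ ψ} → RP (φ ∷ ψ ∷ Γ) Δ Π → RP (φ ∧' ψ ∷ Γ) Δ Π
  ∧b¹     : ∀ {Γ Δ Π φ ψ} → RP Γ (φ ∷ ψ ∷ Δ) Π → RP Γ (φ ∧' ψ ∷ Δ) Π
  ∧b²     : ∀ {Γ Δ Π φ ψ} → RP Γ (φ ∷ Δ) (φ ∷ Π) → RP Γ (φ ∧' ψ ∷ Δ) Π
  ∧b³     : ∀ {Γ Δ Π φ ψ} → RP Γ (ψ ∷ Δ) (ψ ∷ Π) → RP Γ (φ ∧' ψ ∷ Δ) Π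
  ∧t¹     : ∀ {Γ Δ Π φ ψ} → RP Γ Δ (φ ∷ Π) → RP Γ Δ (φ ∧' ψ ∷ Π)
  ∧t²     : ∀ {Γ Δ Π φ ψ} → RP Γ Δ (ψ ∷ Π) → RP Γ Δ (φ ∧' ψ ∷ Π)
  ⊃f¹     : ∀ {Γ Δ Π φ ψ} → RP Γ (φ ∷ Δ) (φ ∷ Π) → RP (φ ⊃ ψ ∷ Γ) Δ Π
  ⊃f²     : ∀ {Γ Δ Π φ ψ} → RP (ψ ∷ Γ) Δ Π → RP (φ ⊃ ψ ∷ Γ) Δ Π
  ⊃b¹     : ∀ {Γ Δ Π φ ψ} → RP Γ (φ ∷ Δ) (φ ∷ Π) → RP Γ (φ ⊃ ψ ∷ Δ) Π
  ⊃b²     : ∀ {Γ Δ Π φ ψ} → RP Γ (ψ ∷ Δ) Π → RP Γ (φ ⊃ ψ ∷ Δ) Π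
  ⊃t      : ∀ {Γ Δ Π φ ψ} → RP (φ ∷ Γ) Δ (ψ ∷ Π) → RP Γ Δ (φ ⊃ ψ ∷ Π)
  sets    : ∀ {Γ Δ Π Γ' Δ' Π'} → SameSet Γ Γ' → SameSet Δ Δ' → SameSet Π Π'
          → RP Γ Δ Π → RP Γ' Δ' Π'

-- A sequent  Σ ; Γ ∪ ∇N ⇒ Δ ; Θ  is represented as  ME Σ Γ N Δ Θ, where
-- Γ collects the 𝒫-formulas of the antecedent and N the constants p such
-- that ∇p occurs in the antecedent.

atoms : List ℕ → List Fm
atoms = map atom

data ME : List ℕ → List Fm → List ℕ → List Fm → List ℕ → Set where
  m1 : ∀ {Σ Γ Π Δ Θ} q → RP Γ (atoms (Θ ++ Π ++ [ q ])) []
     → ME (q ∷ Σ) Γ Π Δ Θ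
  m2 : ∀ {Σ Γ Π Δ Θ} → SP (atoms Σ ++ Γ) (Δ ++ atoms Π) (Δ ++ atoms Σ)
     → ME Σ Γ Π Δ Θ
  m3 : ∀ {Σ Γ N Δ Θ} q → ME (q ∷ Σ) Γ N Δ Θ → ME Σ Γ (q ∷ N) Δ Θ
     → ME Σ Γ N Δ (q ∷ Θ)
  sets : ∀ {Σ Γ N Δ Θ Σ' Γ' N' Δ' Θ'} → SameSet Σ Σ' → SameSet Γ Γ'
       → SameSet N N' → SameSet Δ Δ' → SameSet Θ Θ'
       → ME Σ Γ N Δ Θ → ME Σ' Γ' N' Δ' Θ'

vars : Fm → List ℕ
vars (atom p) = [ p ]
vars bot      = []
vars (neg φ)  = vars φ
vars (φ ∧' ψ) = vars φ ++ vars ψ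
vars (φ ⊃ ψ)  = vars φ ++ vars ψ

Var : List Fm → List ℕ
Var = concatMap vars

-- Read ME Σ Γ N Δ Θ as: every minimally inconsistent model of Γ that is 𝐛 on Σ and not 𝐛 on N
-- models some formula of Δ. Reading the truth tables of the connectives in one direction shows
-- that S-provable sequents are satisfied by every interpretation, in the other that R-provable
-- anti-sequents are falsified by some interpretation. Then every ME rule is sound for the
-- reading: (m3) splits on whether q is 𝐛, and a falsifier of the premiss of (m1), restricted to
-- Var Γ, would be a model of Γ strictly less inconsistent than a minimal one.
-- Conversely, every sequent is S-provable or R-provable. Applying (m3) to all variables of Γ, Δ
-- leaves sequents Σ ; Γ ∪ ∇N ⇒ Δ ; ∅ with Var(Γ ∪ Δ) ⊆ Σ ∪ N. If the premiss of (m2) is not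
-- S-provable, it has a falsifier: a model of Γ, 𝐛 on Σ, not 𝐛 on N, failing Δ. Either some
-- Γ ∤ N, q ∤ ∅ with q ∈ Σ is R-provable and (m1) applies, or the falsifier restricted to
-- Var(Γ ∪ Δ) is a minimally inconsistent model of Γ failing Δ, contradicting Γ ⊨ Δ.

module Submission where

open import Defs
open import Data.Nat using (ℕ) renaming (_≟_ to _≟ℕ_)
open import Data.List using (List; []; _∷_; _++_; [_])
open import Data.List.Properties using (++-identityʳ)
open import Data.List.Membership.Propositional using (_∈_; _∉_; find; lose)
open import Data.List.Membership.Propositional.Properties using (∈-map⁺)
open import Data.List.Relation.Unary.All as All using (All; []; _∷_)
open import Data.List.Relation.Unary.All.Properties using (All¬⇒¬Any)
open import Data.List.Relation.Unary.Any as Any using (Any; here; there; any?)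
import Data.List.Relation.Unary.Any.Properties as Anyₚ
open import Data.List.Relation.Binary.Subset.Propositional using (_⊆_)
open import Data.List.Relation.Binary.Subset.Propositional.Properties
  using (Any-resp-⊆; All-resp-⊇; concatMap⁺; xs⊆xs++ys; xs⊆ys++xs; ⊆-reflexive-↭)
open import Data.List.Relation.Binary.Permutation.Propositional using (↭-sym)
open import Data.List.Relation.Binary.Permutation.Propositional.Properties using (shift)
open import Data.Product using (_×_; ∃; _,_; proj₁; proj₂; uncurry)
open import Data.Sum as Sum using (_⊎_; inj₁; inj₂; [_,_]′; assocˡ; assocʳ; reduce)
open import Data.Empty using (⊥; ⊥-elim)
open import Function using (_∘_; id)
open import Function.Bundles using (_⇔_; mk⇔; Equivalence)
open import Relation.Nullary using (¬_; Dec; yes; no)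
open import Relation.Nullary.Decidable using (map′; _×-dec_)
open import Relation.Binary.Definitions using (DecidableEquality)
open import Relation.Binary.PropositionalEquality using (_≡_; _≢_; refl; sym; trans; cong; cong₂; subst)

open Equivalence using (to; from)

private variable
  A B C R S : Set
  a b v : V
  I J : Interp
  φ : Fm
  Γ Γ′ Δ Δ′ Π Π′ P₁ P₂ P₃ : List Fm
  p q : ℕ
  Σ Σ′ N N′ Θ Θ′ X : List ℕ

infix 4 _≟_

_≟_ : DecidableEquality Fm
atom p ≟ atom q = map′ (cong atom) (λ { refl → refl }) (p ≟ℕ q)
bot ≟ bot = yes refl
neg φ ≟ neg ψ = map′ (cong neg) (λ { refl → refl }) (φ ≟ ψ)
(φ ∧' ψ) ≟ (φ′ ∧' ψ′) = map′ (uncurry (cong₂ _∧'_)) (λ { refl → refl , refl }) (φ ≟ φ′ ×-dec ψ ≟ ψ′)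
(φ ⊃ ψ) ≟ (φ′ ⊃ ψ′) = map′ (uncurry (cong₂ _⊃_)) (λ { refl → refl , refl }) (φ ≟ φ′ ×-dec ψ ≟ ψ′)
atom _ ≟ bot = no λ ()
atom _ ≟ neg _ = no λ ()
atom _ ≟ (_ ∧' _) = no λ ()
atom _ ≟ (_ ⊃ _) = no λ ()
bot ≟ atom _ = no λ ()
bot ≟ neg _ = no λ ()
bot ≟ (_ ∧' _) = no λ ()
bot ≟ (_ ⊃ _) = no λ ()
neg _ ≟ atom _ = no λ ()
neg _ ≟ bot = no λ ()
neg _ ≟ (_ ∧' _) = no λ ()
neg _ ≟ (_ ⊃ _) = no λ ()
(_ ∧' _) ≟ atom _ = no λ ()
(_ ∧' _) ≟ bot = no λ ()
(_ ∧' _) ≟ neg _ = no λ ()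
(_ ∧' _) ≟ (_ ⊃ _) = no λ ()
(_ ⊃ _) ≟ atom _ = no λ ()
(_ ⊃ _) ≟ bot = no λ ()
(_ ⊃ _) ≟ neg _ = no λ ()
(_ ⊃ _) ≟ (_ ∧' _) = no λ ()

open import Data.List.Membership.DecPropositional _≟_ using (_∈?_)
open import Data.List.Membership.DecPropositional _≟ℕ_ using () renaming (_∈?_ to _∈ℕ?_)

both : A ⊎ R → B ⊎ S → (A × B) ⊎ (R ⊎ S)
both (inj₁ x) (inj₁ y) = inj₁ (x , y)
both (inj₁ _) (inj₂ s) = inj₂ (inj₂ s)
both (inj₂ r) _        = inj₂ (inj₁ r)

both′ : A ⊎ R → B ⊎ R → (A × B) ⊎ R
both′ x y = Sum.map₂ reduce (both x y)

peel : (C → A ⊎ S) → (S → B ⊎ R) → C → (A ⊎ B) ⊎ R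
peel f g = assocˡ ∘ Sum.map₂ g ∘ f

unpeel : (A ⊎ S → C) → (B ⊎ R → S) → (A ⊎ B) ⊎ R → C
unpeel f g = f ∘ Sum.map₂ g ∘ assocʳ

⊆-of : {X Y : List A} → SameSet X Y → X ⊆ Y
⊆-of s = proj₁ (s _)

⊇-of : {X Y : List A} → SameSet X Y → Y ⊆ X
⊇-of s = proj₂ (s _)

sameSet-refl : {X : List A} → SameSet X X
sameSet-refl _ = id , id

sameSet-∷ : {x : A} {X : List A} → x ∈ X → SameSet (x ∷ X) X
sameSet-∷ x∈ _ = (λ { (here refl) → x∈ ; (there y∈) → y∈ }) , there

sameSet-shift : {x : A} (X : List A) {Y : List A} → SameSet (X ++ x ∷ Y) (x ∷ X ++ Y)
sameSet-shift X _ = ⊆-reflexive-↭ (shift _ X _) , ⊆-reflexive-↭ (↭-sym (shift _ X _))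

sameSet-++-[] : (X : List A) → SameSet (X ++ []) X
sameSet-++-[] X rewrite ++-identityʳ X = sameSet-refl

negV-injective : negV a ≡ negV b → a ≡ b
negV-injective {𝐟} {𝐟} _ = refl
negV-injective {𝐛} {𝐛} _ = refl
negV-injective {𝐭} {𝐭} _ = refl

minV-𝐟 : minV a b ≡ 𝐟 ⇔ (a ≡ 𝐟 ⊎ b ≡ 𝐟)
minV-𝐟 = mk⇔ ⇒ ⇐
  where
  ⇒ : minV a b ≡ 𝐟 → a ≡ 𝐟 ⊎ b ≡ 𝐟
  ⇒ {𝐟} _ = inj₁ refl
  ⇒ {𝐛} {𝐟} _ = inj₂ refl
  ⇒ {𝐭} e = inj₂ e
  ⇐ : a ≡ 𝐟 ⊎ b ≡ 𝐟 → minV a b ≡ 𝐟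
  ⇐ (inj₁ refl) = refl
  ⇐ {𝐟} (inj₂ refl) = refl
  ⇐ {𝐛} (inj₂ refl) = refl
  ⇐ {𝐭} (inj₂ refl) = refl

minV-𝐛 : minV a b ≡ 𝐛 ⇔ ((a ≡ 𝐛 ⊎ b ≡ 𝐛) × (a ≡ 𝐛 ⊎ a ≡ 𝐭) × (b ≡ 𝐛 ⊎ b ≡ 𝐭))
minV-𝐛 = mk⇔ ⇒ ⇐
  where
  ⇒ : minV a b ≡ 𝐛 → (a ≡ 𝐛 ⊎ b ≡ 𝐛) × (a ≡ 𝐛 ⊎ a ≡ 𝐭) × (b ≡ 𝐛 ⊎ b ≡ 𝐭)
  ⇒ {𝐛} {𝐛} _ = inj₁ refl , inj₁ refl , inj₁ refl
  ⇒ {𝐛} {𝐭} _ = inj₁ refl , inj₁ refl , inj₂ refl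
  ⇒ {𝐭} {𝐛} _ = inj₂ refl , inj₂ refl , inj₁ refl
  ⇐ : (a ≡ 𝐛 ⊎ b ≡ 𝐛) × (a ≡ 𝐛 ⊎ a ≡ 𝐭) × (b ≡ 𝐛 ⊎ b ≡ 𝐭) → minV a b ≡ 𝐛
  ⇐ (inj₁ refl , _ , inj₁ refl) = refl
  ⇐ (inj₁ refl , _ , inj₂ refl) = refl
  ⇐ (inj₂ refl , inj₁ refl , _) = refl
  ⇐ (inj₂ refl , inj₂ refl , _) = refl

minV-𝐭 : minV a b ≡ 𝐭 ⇔ (a ≡ 𝐭 × b ≡ 𝐭)
minV-𝐭 = mk⇔ ⇒ ⇐
  where
  ⇒ : minV a b ≡ 𝐭 → a ≡ 𝐭 × b ≡ 𝐭
  ⇒ {𝐭} e = refl , e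
  ⇒ {𝐛} {𝐟} ()
  ⇒ {𝐛} {𝐛} ()
  ⇒ {𝐛} {𝐭} ()
  ⇐ : a ≡ 𝐭 × b ≡ 𝐭 → minV a b ≡ 𝐭
  ⇐ (refl , refl) = refl

impV-𝐭 : impV a b ≡ 𝐭 ⇔ (a ≡ 𝐟 ⊎ b ≡ 𝐭)
impV-𝐭 = mk⇔ ⇒ ⇐
  where
  ⇒ : impV a b ≡ 𝐭 → a ≡ 𝐟 ⊎ b ≡ 𝐭
  ⇒ {𝐟} _ = inj₁ refl
  ⇒ {𝐛} e = inj₂ e
  ⇒ {𝐭} e = inj₂ e
  ⇐ : a ≡ 𝐟 ⊎ b ≡ 𝐭 → impV a b ≡ 𝐭
  ⇐ (inj₁ refl) = refl
  ⇐ {𝐟} (inj₂ refl) = refl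
  ⇐ {𝐛} (inj₂ refl) = refl
  ⇐ {𝐭} (inj₂ refl) = refl

impV-≢𝐭 : v ≢ 𝐭 → impV a b ≡ v ⇔ ((a ≡ 𝐛 ⊎ a ≡ 𝐭) × b ≡ v)
impV-≢𝐭 {v} v≢𝐭 = mk⇔ ⇒ ⇐
  where
  ⇒ : impV a b ≡ v → (a ≡ 𝐛 ⊎ a ≡ 𝐭) × b ≡ v
  ⇒ {𝐟} e = ⊥-elim (v≢𝐭 (sym e))
  ⇒ {𝐛} e = inj₁ refl , e
  ⇒ {𝐭} e = inj₂ refl , e
  ⇐ : (a ≡ 𝐛 ⊎ a ≡ 𝐭) × b ≡ v → impV a b ≡ v
  ⇐ (inj₁ refl , e) = e
  ⇐ (inj₂ refl , e) = e

≢𝐟⇒designated : v ≢ 𝐟 → Designated v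
≢𝐟⇒designated {𝐟} v≢𝐟 = ⊥-elim (v≢𝐟 refl)
≢𝐟⇒designated {𝐛} _ = des-b
≢𝐟⇒designated {𝐭} _ = des-t

designated-cases : Designated v → v ≡ 𝐛 ⊎ v ≡ 𝐭
designated-cases des-b = inj₁ refl
designated-cases des-t = inj₂ refl

𝐛≢𝐟 : 𝐛 ≢ 𝐟
𝐛≢𝐟 ()

𝐛≢𝐭 : 𝐛 ≢ 𝐭
𝐛≢𝐭 ()

_≟𝐛 : ∀ v → Dec (v ≡ 𝐛)
𝐟 ≟𝐛 = no λ ()
𝐛 ≟𝐛 = yes refl
𝐭 ≟𝐛 = no λ ()

neither-𝐟-nor-𝐭 : v ≢ 𝐟 → v ≢ 𝐭 → v ≡ 𝐛
neither-𝐟-nor-𝐭 {𝐟} v≢𝐟 _ = ⊥-elim (v≢𝐟 refl)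
neither-𝐟-nor-𝐭 {𝐛} _ _ = refl
neither-𝐟-nor-𝐭 {𝐭} _ v≢𝐭 = ⊥-elim (v≢𝐭 refl)

Takes : Interp → V → List Fm → Set
Takes I v = Any (λ φ → val I φ ≡ v)

infix 4 _⊨_∣_∣_

_⊨_∣_∣_ : Interp → List Fm → List Fm → List Fm → Set
I ⊨ Γ ∣ Δ ∣ Π = Takes I 𝐟 Γ ⊎ Takes I 𝐛 Δ ⊎ Takes I 𝐭 Π

⊨-∷₁⁻ : I ⊨ φ ∷ Γ ∣ Δ ∣ Π → val I φ ≡ 𝐟 ⊎ I ⊨ Γ ∣ Δ ∣ Π
⊨-∷₁⁻ (inj₁ (here e))  = inj₁ e
⊨-∷₁⁻ (inj₁ (there s)) = inj₂ (inj₁ s)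
⊨-∷₁⁻ (inj₂ s)         = inj₂ (inj₂ s)

⊨-∷₁⁺ : val I φ ≡ 𝐟 ⊎ I ⊨ Γ ∣ Δ ∣ Π → I ⊨ φ ∷ Γ ∣ Δ ∣ Π
⊨-∷₁⁺ (inj₁ e)        = inj₁ (here e)
⊨-∷₁⁺ (inj₂ (inj₁ s)) = inj₁ (there s)
⊨-∷₁⁺ (inj₂ (inj₂ s)) = inj₂ s

⊨-∷₂⁻ : I ⊨ Γ ∣ φ ∷ Δ ∣ Π → val I φ ≡ 𝐛 ⊎ I ⊨ Γ ∣ Δ ∣ Π
⊨-∷₂⁻ (inj₁ s)                = inj₂ (inj₁ s)
⊨-∷₂⁻ (inj₂ (inj₁ (here e)))  = inj₁ e
⊨-∷₂⁻ (inj₂ (inj₁ (there s))) = inj₂ (inj₂ (inj₁ s))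
⊨-∷₂⁻ (inj₂ (inj₂ s))         = inj₂ (inj₂ (inj₂ s))

⊨-∷₂⁺ : val I φ ≡ 𝐛 ⊎ I ⊨ Γ ∣ Δ ∣ Π → I ⊨ Γ ∣ φ ∷ Δ ∣ Π
⊨-∷₂⁺ (inj₁ e)                = inj₂ (inj₁ (here e))
⊨-∷₂⁺ (inj₂ (inj₁ s))         = inj₁ s
⊨-∷₂⁺ (inj₂ (inj₂ (inj₁ s)))  = inj₂ (inj₁ (there s))
⊨-∷₂⁺ (inj₂ (inj₂ (inj₂ s)))  = inj₂ (inj₂ s)

⊨-∷₃⁻ : I ⊨ Γ ∣ Δ ∣ φ ∷ Π → val I φ ≡ 𝐭 ⊎ I ⊨ Γ ∣ Δ ∣ Π
⊨-∷₃⁻ (inj₁ s)                = inj₂ (inj₁ s)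
⊨-∷₃⁻ (inj₂ (inj₁ s))         = inj₂ (inj₂ (inj₁ s))
⊨-∷₃⁻ (inj₂ (inj₂ (here e)))  = inj₁ e
⊨-∷₃⁻ (inj₂ (inj₂ (there s))) = inj₂ (inj₂ (inj₂ s))

⊨-∷₃⁺ : val I φ ≡ 𝐭 ⊎ I ⊨ Γ ∣ Δ ∣ Π → I ⊨ Γ ∣ Δ ∣ φ ∷ Π
⊨-∷₃⁺ (inj₁ e)               = inj₂ (inj₂ (here e))
⊨-∷₃⁺ (inj₂ (inj₁ s))        = inj₁ s
⊨-∷₃⁺ (inj₂ (inj₂ (inj₁ s))) = inj₂ (inj₁ s)
⊨-∷₃⁺ (inj₂ (inj₂ (inj₂ s))) = inj₂ (inj₂ (there s))

⊨-mono : Γ ⊆ Γ′ → Δ ⊆ Δ′ → Π ⊆ Π′ → I ⊨ Γ ∣ Δ ∣ Π → I ⊨ Γ′ ∣ Δ′ ∣ Π′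
⊨-mono f g h = Sum.map (Any-resp-⊆ f) (Sum.map (Any-resp-⊆ g) (Any-resp-⊆ h))

¬Takes𝐟⇒ModelOf : ¬ Takes I 𝐟 Γ → ModelOf I Γ
¬Takes𝐟⇒ModelOf ¬takes = All.tabulate λ φ∈ → ≢𝐟⇒designated (¬takes ∘ lose φ∈)

ModelOf⇒¬Takes𝐟 : ModelOf I Γ → ¬ Takes I 𝐟 Γ
ModelOf⇒¬Takes𝐟 model takes with find takes
... | _ , φ∈ , e with subst Designated e (All.lookup model φ∈)
... | ()

takes-atoms : Takes I v (atoms X) → ∃ λ p → p ∈ X × I p ≡ v
takes-atoms = find ∘ Anyₚ.map⁻

¬takes-atoms : ¬ Takes I v (atoms X) → p ∈ X → I p ≢ v
¬takes-atoms ¬takes p∈ = ¬takes ∘ lose (∈-map⁺ atom p∈)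

SP-sound : SP Γ Δ Π → ∀ I → I ⊨ Γ ∣ Δ ∣ Π
SP-sound (ax φ) I with val I φ in e
... | 𝐟 = inj₁ (here e)
... | 𝐛 = inj₂ (inj₁ (here e))
... | 𝐭 = inj₂ (inj₂ (here e))
SP-sound ax⊥ I = inj₁ (here refl)
SP-sound (¬f d) I = ⊨-∷₁⁺ (Sum.map₁ (cong negV) (⊨-∷₃⁻ (SP-sound d I)))
SP-sound (¬b d) I = ⊨-∷₂⁺ (Sum.map₁ (cong negV) (⊨-∷₂⁻ (SP-sound d I)))
SP-sound (¬t d) I = ⊨-∷₃⁺ (Sum.map₁ (cong negV) (⊨-∷₁⁻ (SP-sound d I)))
SP-sound (∧f d) I = ⊨-∷₁⁺ (Sum.map₁ (from minV-𝐟) (peel ⊨-∷₁⁻ ⊨-∷₁⁻ (SP-sound d I)))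
SP-sound (∧t d e) I =
  ⊨-∷₃⁺ (Sum.map₁ (from minV-𝐭) (both′ (⊨-∷₃⁻ (SP-sound d I)) (⊨-∷₃⁻ (SP-sound e I))))
SP-sound (∧b d e f) I =
  ⊨-∷₂⁺ (Sum.map₁ (from minV-𝐛)
    (both′ (peel ⊨-∷₂⁻ ⊨-∷₂⁻ (SP-sound d I))
      (both′ (peel ⊨-∷₂⁻ ⊨-∷₃⁻ (SP-sound e I)) (peel ⊨-∷₂⁻ ⊨-∷₃⁻ (SP-sound f I)))))
SP-sound (⊃f d e) I =
  ⊨-∷₁⁺ (Sum.map₁ (from (impV-≢𝐭 λ ()))
    (both′ (peel ⊨-∷₂⁻ ⊨-∷₃⁻ (SP-sound d I)) (⊨-∷₁⁻ (SP-sound e I))))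
SP-sound (⊃b d e) I =
  ⊨-∷₂⁺ (Sum.map₁ (from (impV-≢𝐭 λ ()))
    (both′ (peel ⊨-∷₂⁻ ⊨-∷₃⁻ (SP-sound d I)) (⊨-∷₂⁻ (SP-sound e I))))
SP-sound (⊃t d) I = ⊨-∷₃⁺ (Sum.map₁ (from impV-𝐭) (peel ⊨-∷₁⁻ ⊨-∷₃⁻ (SP-sound d I)))
SP-sound (weak₁ φ d) I = ⊨-∷₁⁺ (inj₂ (SP-sound d I))
SP-sound (weak₂ φ d) I = ⊨-∷₂⁺ (inj₂ (SP-sound d I))
SP-sound (weak₃ φ d) I = ⊨-∷₃⁺ (inj₂ (SP-sound d I))
SP-sound (sets f g h d) I = ⊨-mono (⊆-of f) (⊆-of g) (⊆-of h) (SP-sound d I)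

Falsifiable : List Fm → List Fm → List Fm → Set
Falsifiable Γ Δ Π = ∃ λ I → ¬ I ⊨ Γ ∣ Δ ∣ Π

falsifiable-by : (∀ {I} → I ⊨ Γ′ ∣ Δ′ ∣ Π′ → I ⊨ Γ ∣ Δ ∣ Π)
               → Falsifiable Γ Δ Π → Falsifiable Γ′ Δ′ Π′
falsifiable-by f (I , ⊭) = I , ⊭ ∘ f

falsifier : List Fm → List Fm → Interp
falsifier Γ₁ Γ₂ p with atom p ∈? Γ₁ | atom p ∈? Γ₂
... | no _  | _     = 𝐟
... | yes _ | no _  = 𝐛
... | yes _ | yes _ = 𝐭

falsifier-𝐟 : ∀ Γ₁ Γ₂ p → falsifier Γ₁ Γ₂ p ≡ 𝐟 → atom p ∉ Γ₁
falsifier-𝐟 Γ₁ Γ₂ p with atom p ∈? Γ₁ | atom p ∈? Γ₂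
... | no p∉ | _     = λ _ → p∉
... | yes _ | no _  = λ ()
... | yes _ | yes _ = λ ()

falsifier-𝐛 : ∀ Γ₁ Γ₂ p → falsifier Γ₁ Γ₂ p ≡ 𝐛 → atom p ∉ Γ₂
falsifier-𝐛 Γ₁ Γ₂ p with atom p ∈? Γ₁ | atom p ∈? Γ₂
... | no _  | _     = λ ()
... | yes _ | no p∉ = λ _ → p∉
... | yes _ | yes _ = λ ()

falsifier-𝐭 : ∀ Γ₁ Γ₂ p → falsifier Γ₁ Γ₂ p ≡ 𝐭 → atom p ∈ Γ₁ × atom p ∈ Γ₂
falsifier-𝐭 Γ₁ Γ₂ p with atom p ∈? Γ₁ | atom p ∈? Γ₂
... | no _   | _      = λ ()
... | yes _  | no _   = λ ()
... | yes p∈₁ | yes p∈₂ = λ _ → p∈₁ , p∈₂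

axiom-falsified : ∀ {Γ₁ Γ₂ Γ₃} → All AtomOrBot Γ₁ → All AtomOrBot Γ₂ → All AtomOrBot Γ₃
                → (∀ φ → φ ∈ Γ₁ → φ ∈ Γ₂ → φ ∈ Γ₃ → ⊥) → bot ∉ Γ₁
                → ¬ falsifier Γ₁ Γ₂ ⊨ Γ₁ ∣ Γ₂ ∣ Γ₃
axiom-falsified {Γ₁} {Γ₂} {Γ₃} at₁ at₂ at₃ disjoint bot∉ =
  [ none at₁ not-𝐟 , [ none at₂ not-𝐛 , none at₃ not-𝐭 ]′ ]′
  where
  F : Interp
  F = falsifier Γ₁ Γ₂
  none : ∀ {Γ v} → All AtomOrBot Γ → (∀ {φ} → AtomOrBot φ → φ ∈ Γ → val F φ ≢ v) → ¬ Takes F v Γ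
  none at f = All¬⇒¬Any (All.tabulate λ φ∈ → f (All.lookup at φ∈) φ∈)
  not-𝐟 : AtomOrBot φ → φ ∈ Γ₁ → val F φ ≢ 𝐟
  not-𝐟 (isAtom p) φ∈ e = falsifier-𝐟 Γ₁ Γ₂ p e φ∈
  not-𝐟 isBot φ∈ _ = bot∉ φ∈
  not-𝐛 : AtomOrBot φ → φ ∈ Γ₂ → val F φ ≢ 𝐛
  not-𝐛 (isAtom p) φ∈ e = falsifier-𝐛 Γ₁ Γ₂ p e φ∈
  not-𝐛 isBot _ ()
  not-𝐭 : AtomOrBot φ → φ ∈ Γ₃ → val F φ ≢ 𝐭
  not-𝐭 (isAtom p) φ∈ e = let φ∈₁ , φ∈₂ = falsifier-𝐭 Γ₁ Γ₂ p e in disjoint _ φ∈₁ φ∈₂ φ∈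
  not-𝐭 isBot _ ()

RP-sound : RP Γ Δ Π → Falsifiable Γ Δ Π
RP-sound (ax at₁ at₂ at₃ disjoint bot∉) = _ , axiom-falsified at₁ at₂ at₃ disjoint bot∉
RP-sound (¬f d) = falsifiable-by (⊨-∷₃⁺ ∘ Sum.map₁ negV-injective ∘ ⊨-∷₁⁻) (RP-sound d)
RP-sound (¬b d) = falsifiable-by (⊨-∷₂⁺ ∘ Sum.map₁ negV-injective ∘ ⊨-∷₂⁻) (RP-sound d)
RP-sound (¬t d) = falsifiable-by (⊨-∷₁⁺ ∘ Sum.map₁ negV-injective ∘ ⊨-∷₃⁻) (RP-sound d)
RP-sound (∧f d) = falsifiable-by (unpeel ⊨-∷₁⁺ ⊨-∷₁⁺ ∘ Sum.map₁ (to minV-𝐟) ∘ ⊨-∷₁⁻) (RP-sound d)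
RP-sound (∧b¹ d) =
  falsifiable-by (unpeel ⊨-∷₂⁺ ⊨-∷₂⁺ ∘ Sum.map₁ (proj₁ ∘ to minV-𝐛) ∘ ⊨-∷₂⁻) (RP-sound d)
RP-sound (∧b² d) =
  falsifiable-by (unpeel ⊨-∷₂⁺ ⊨-∷₃⁺ ∘ Sum.map₁ (proj₁ ∘ proj₂ ∘ to minV-𝐛) ∘ ⊨-∷₂⁻) (RP-sound d)
RP-sound (∧b³ d) =
  falsifiable-by (unpeel ⊨-∷₂⁺ ⊨-∷₃⁺ ∘ Sum.map₁ (proj₂ ∘ proj₂ ∘ to minV-𝐛) ∘ ⊨-∷₂⁻) (RP-sound d)
RP-sound (∧t¹ d) = falsifiable-by (⊨-∷₃⁺ ∘ Sum.map₁ (proj₁ ∘ to minV-𝐭) ∘ ⊨-∷₃⁻) (RP-sound d)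
RP-sound (∧t² d) = falsifiable-by (⊨-∷₃⁺ ∘ Sum.map₁ (proj₂ ∘ to minV-𝐭) ∘ ⊨-∷₃⁻) (RP-sound d)
RP-sound (⊃f¹ d) =
  falsifiable-by (unpeel ⊨-∷₂⁺ ⊨-∷₃⁺ ∘ Sum.map₁ (proj₁ ∘ to (impV-≢𝐭 λ ())) ∘ ⊨-∷₁⁻) (RP-sound d)
RP-sound (⊃f² d) =
  falsifiable-by (⊨-∷₁⁺ ∘ Sum.map₁ (proj₂ ∘ to (impV-≢𝐭 λ ())) ∘ ⊨-∷₁⁻) (RP-sound d)
RP-sound (⊃b¹ d) =
  falsifiable-by (unpeel ⊨-∷₂⁺ ⊨-∷₃⁺ ∘ Sum.map₁ (proj₁ ∘ to (impV-≢𝐭 λ ())) ∘ ⊨-∷₂⁻) (RP-sound d)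
RP-sound (⊃b² d) =
  falsifiable-by (⊨-∷₂⁺ ∘ Sum.map₁ (proj₂ ∘ to (impV-≢𝐭 λ ())) ∘ ⊨-∷₂⁻) (RP-sound d)
RP-sound (⊃t d) = falsifiable-by (unpeel ⊨-∷₁⁺ ⊨-∷₃⁺ ∘ Sum.map₁ (to impV-𝐭) ∘ ⊨-∷₃⁻) (RP-sound d)
RP-sound (sets f g h d) = falsifiable-by (⊨-mono (⊇-of f) (⊇-of g) (⊇-of h)) (RP-sound d)

-- Every sequent is S-provable or R-provable

Decided : List Fm → List Fm → List Fm → Set
Decided Γ Δ Π = SP Γ Δ Π ⊎ RP Γ Δ Π

decided-sets : SameSet Γ Γ′ → SameSet Δ Δ′ → SameSet Π Π′ → Decided Γ Δ Π → Decided Γ′ Δ′ Π′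
decided-sets f g h = Sum.map (sets f g h) (sets f g h)

Atomic : List Fm → List Fm → List Fm → Set
Atomic A₁ A₂ A₃ = All AtomOrBot A₁ × All AtomOrBot A₂ × All AtomOrBot A₃

decide-atomic : ∀ {A₁ A₂ A₃} → Atomic A₁ A₂ A₃ → Decided A₁ A₂ A₃
decide-atomic {A₁} {A₂} {A₃} (at₁ , at₂ , at₃)
  with bot ∈? A₁ | any? (λ φ → φ ∈? A₂ ×-dec φ ∈? A₃) A₁
... | yes bot∈ | _ = inj₁ (sets (sameSet-∷ bot∈) sameSet-refl sameSet-refl ax⊥)
... | no _ | yes common =
  let φ , φ∈₁ , φ∈₂ , φ∈₃ = find common
  in inj₁ (sets (sameSet-∷ φ∈₁) (sameSet-∷ φ∈₂) (sameSet-∷ φ∈₃) (ax φ))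
... | no bot∉ | no none =
  inj₂ (ax at₁ at₂ at₃ (λ φ φ∈₁ φ∈₂ φ∈₃ → none (lose φ∈₁ (φ∈₂ , φ∈₃))) bot∉)

-- Decomposing a formula can add subformulas to several components (as (∧:𝐛) does), so
-- the recursion is on formulas, with the procedure for the remaining pending formulas P
-- as a continuation; atomic formulas are set aside until the axioms can be checked.
DecidedOverAtomic : List Fm → List Fm → List Fm → Set
DecidedOverAtomic P₁ P₂ P₃ =
  ∀ {A₁ A₂ A₃} → Atomic A₁ A₂ A₃ → Decided (P₁ ++ A₁) (P₂ ++ A₂) (P₃ ++ A₃)

module _ {P₁ P₂ P₃ : List Fm} (k : DecidedOverAtomic P₁ P₂ P₃) {φ : Fm} (atomic : AtomOrBot φ) where

  shelve₁ : DecidedOverAtomic (φ ∷ P₁) P₂ P₃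
  shelve₁ (at₁ , at₂ , at₃) =
    decided-sets (sameSet-shift P₁) sameSet-refl sameSet-refl (k (atomic ∷ at₁ , at₂ , at₃))

  shelve₂ : DecidedOverAtomic P₁ (φ ∷ P₂) P₃
  shelve₂ (at₁ , at₂ , at₃) =
    decided-sets sameSet-refl (sameSet-shift P₂) sameSet-refl (k (at₁ , atomic ∷ at₂ , at₃))

  shelve₃ : DecidedOverAtomic P₁ P₂ (φ ∷ P₃)
  shelve₃ (at₁ , at₂ , at₃) =
    decided-sets sameSet-refl sameSet-refl (sameSet-shift P₃) (k (at₁ , at₂ , atomic ∷ at₃))

decided-∷₁ : ∀ φ → DecidedOverAtomic P₁ P₂ P₃ → DecidedOverAtomic (φ ∷ P₁) P₂ P₃
decided-∷₂ : ∀ φ → DecidedOverAtomic P₁ P₂ P₃ → DecidedOverAtomic P₁ (φ ∷ P₂) P₃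
decided-∷₃ : ∀ φ → DecidedOverAtomic P₁ P₂ P₃ → DecidedOverAtomic P₁ P₂ (φ ∷ P₃)

decided-∷₁ (atom p) k = shelve₁ k (isAtom p)
decided-∷₁ bot k = shelve₁ k isBot
decided-∷₁ (neg φ) k at = Sum.map ¬f ¬f (decided-∷₃ φ k at)
decided-∷₁ (φ ∧' ψ) k at = Sum.map ∧f ∧f (decided-∷₁ φ (decided-∷₁ ψ k) at)
decided-∷₁ (φ ⊃ ψ) k at =
  Sum.map (uncurry ⊃f) [ ⊃f¹ , ⊃f² ]′
    (both (decided-∷₂ φ (decided-∷₃ φ k) at) (decided-∷₁ ψ k at))

decided-∷₂ (atom p) k = shelve₂ k (isAtom p)
decided-∷₂ bot k = shelve₂ k isBot
decided-∷₂ (neg φ) k at = Sum.map ¬b ¬b (decided-∷₂ φ k at)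
decided-∷₂ (φ ∧' ψ) k at =
  Sum.map (λ (d , e , f) → ∧b d e f) [ ∧b¹ , [ ∧b² , ∧b³ ]′ ]′
    (both (decided-∷₂ φ (decided-∷₂ ψ k) at)
      (both (decided-∷₂ φ (decided-∷₃ φ k) at) (decided-∷₂ ψ (decided-∷₃ ψ k) at)))
decided-∷₂ (φ ⊃ ψ) k at =
  Sum.map (uncurry ⊃b) [ ⊃b¹ , ⊃b² ]′
    (both (decided-∷₂ φ (decided-∷₃ φ k) at) (decided-∷₂ ψ k at))

decided-∷₃ (atom p) k = shelve₃ k (isAtom p)
decided-∷₃ bot k = shelve₃ k isBot
decided-∷₃ (neg φ) k at = Sum.map ¬t ¬t (decided-∷₁ φ k at)
decided-∷₃ (φ ∧' ψ) k at =
  Sum.map (uncurry ∧t) [ ∧t¹ , ∧t² ]′ (both (decided-∷₃ φ k at) (decided-∷₃ ψ k at))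
decided-∷₃ (φ ⊃ ψ) k at = Sum.map ⊃t ⊃t (decided-∷₁ φ (decided-∷₃ ψ k) at)

decidedOverAtomic : ∀ P₁ P₂ P₃ → DecidedOverAtomic P₁ P₂ P₃
decidedOverAtomic (φ ∷ P₁) P₂ P₃ = decided-∷₁ φ (decidedOverAtomic P₁ P₂ P₃)
decidedOverAtomic [] (φ ∷ P₂) P₃ = decided-∷₂ φ (decidedOverAtomic [] P₂ P₃)
decidedOverAtomic [] [] (φ ∷ P₃) = decided-∷₃ φ (decidedOverAtomic [] [] P₃)
decidedOverAtomic [] [] [] = decide-atomic

decide : ∀ Γ Δ Π → Decided Γ Δ Π
decide Γ Δ Π =
  decided-sets (sameSet-++-[] Γ) (sameSet-++-[] Δ) (sameSet-++-[] Π)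
    (decidedOverAtomic Γ Δ Π ([] , [] , []))

vars⊆Var : φ ∈ Γ → vars φ ⊆ Var Γ
vars⊆Var φ∈ p∈ = Anyₚ.concatMap⁺ vars (Any.map (λ { refl → p∈ }) φ∈)

Var⊆Var-++ˡ : ∀ Γ Δ → Var Γ ⊆ Var (Γ ++ Δ)
Var⊆Var-++ˡ Γ Δ = concatMap⁺ vars (xs⊆xs++ys Γ Δ)

Var⊆Var-++ʳ : ∀ Γ Δ → Var Δ ⊆ Var (Γ ++ Δ)
Var⊆Var-++ʳ Γ Δ = concatMap⁺ vars (xs⊆ys++xs Δ Γ)

val-cong : (∀ {p} → p ∈ vars φ → I p ≡ J p) → val I φ ≡ val J φ
val-cong {atom p} f = f (here refl)
val-cong {bot} f = refl
val-cong {neg φ} f = cong negV (val-cong {φ} f)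
val-cong {φ ∧' ψ} f =
  cong₂ minV (val-cong {φ} (f ∘ xs⊆xs++ys _ _)) (val-cong {ψ} (f ∘ xs⊆ys++xs _ (vars φ)))
val-cong {φ ⊃ ψ} f =
  cong₂ impV (val-cong {φ} (f ∘ xs⊆xs++ys _ _)) (val-cong {ψ} (f ∘ xs⊆ys++xs _ (vars φ)))

restrict : List ℕ → Interp → Interp
restrict X I p with p ∈ℕ? X
... | yes _ = I p
... | no _  = 𝐭

restrict-∈ : p ∈ X → restrict X I p ≡ I p
restrict-∈ {p} {X} p∈ with p ∈ℕ? X
... | yes _ = refl
... | no p∉ = ⊥-elim (p∉ p∈)

restrict-𝐛 : restrict X I p ≡ 𝐛 → p ∈ X × I p ≡ 𝐛
restrict-𝐛 {X} {I} {p} with p ∈ℕ? X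
... | yes p∈ = p∈ ,_
... | no _   = λ ()

val-restrict : vars φ ⊆ X → val (restrict X I) φ ≡ val I φ
val-restrict {φ} sub = val-cong {φ} (restrict-∈ ∘ sub)

restrict-model : Var Γ ⊆ X → ModelOf I Γ → ModelOf (restrict X I) Γ
restrict-model sub model = All.tabulate λ {φ} φ∈ →
  subst Designated (sym (val-restrict {φ} (sub ∘ vars⊆Var φ∈))) (All.lookup model φ∈)

-- Soundness of ME

infix 4 _⊆_∪_∪_

_⊆_∪_∪_ : List ℕ → List ℕ → List ℕ → List ℕ → Set
X ⊆ Σ ∪ N ∪ Θ = ∀ {p} → p ∈ X → p ∈ Σ ⊎ p ∈ N ⊎ p ∈ Θ

move-to-Σ : X ⊆ Σ ∪ N ∪ (q ∷ Θ) → X ⊆ (q ∷ Σ) ∪ N ∪ Θ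
move-to-Σ cov p∈ with cov p∈
... | inj₁ p∈Σ                = inj₁ (there p∈Σ)
... | inj₂ (inj₁ p∈N)         = inj₂ (inj₁ p∈N)
... | inj₂ (inj₂ (here refl)) = inj₁ (here refl)
... | inj₂ (inj₂ (there p∈Θ)) = inj₂ (inj₂ p∈Θ)

move-to-N : X ⊆ Σ ∪ N ∪ (q ∷ Θ) → X ⊆ Σ ∪ (q ∷ N) ∪ Θ
move-to-N cov p∈ with cov p∈
... | inj₁ p∈Σ                = inj₁ p∈Σ
... | inj₂ (inj₁ p∈N)         = inj₂ (inj₁ (there p∈N))
... | inj₂ (inj₂ (here refl)) = inj₂ (inj₁ (here refl))
... | inj₂ (inj₂ (there p∈Θ)) = inj₂ (inj₂ p∈Θ)

cover-sets : SameSet Γ Γ′ → SameSet Σ Σ′ → SameSet N N′ → SameSet Θ Θ′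
           → Var Γ′ ⊆ Σ′ ∪ N′ ∪ Θ′ → Var Γ ⊆ Σ ∪ N ∪ Θ
cover-sets fΓ fΣ fN fΘ cov =
  Sum.map (⊇-of fΣ) (Sum.map (⊇-of fN) (⊇-of fΘ)) ∘ cov ∘ concatMap⁺ vars (⊆-of fΓ)

minInconsModel-sets : SameSet Γ Γ′ → MinInconsModel Γ′ I → MinInconsModel Γ I
minInconsModel-sets fΓ (model , minimal) =
  All-resp-⊇ (⊆-of fΓ) model ,
  λ (J , J-model , smaller) → minimal (J , All-resp-⊇ (⊇-of fΓ) J-model , smaller)

smaller-inconsistency : ModelOf J Γ → (∀ {p} → p ∈ Var Γ → J p ≡ 𝐛 → I p ≡ 𝐛)
                      → I q ≡ 𝐛 → J q ≢ 𝐛 → ∃ λ J′ → ModelOf J′ Γ × InconsStrictSub J′ I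
smaller-inconsistency {J = J} {Γ = Γ} J-model below Iq Jq =
  restrict (Var Γ) J , restrict-model {I = J} id J-model ,
  (λ p e → uncurry below (restrict-𝐛 {Var Γ} e)) , _ , Iq , Jq ∘ proj₂ ∘ restrict-𝐛 {Var Γ}

leaf-sequent-satisfied : ModelOf I Γ → (∀ {p} → p ∈ Σ → I p ≡ 𝐛) → (∀ {p} → p ∈ N → I p ≢ 𝐛)
                       → I ⊨ atoms Σ ++ Γ ∣ Δ ++ atoms N ∣ Δ ++ atoms Σ → Any (Models I) Δ
leaf-sequent-satisfied {Σ = Σ} model Σ-𝐛 N-≢𝐛 (inj₁ takes) with Anyₚ.++⁻ (atoms Σ) takes
... | inj₁ takesΣ = let _ , p∈ , Ip = takes-atoms takesΣ in ⊥-elim (𝐛≢𝐟 (trans (sym (Σ-𝐛 p∈)) Ip))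
... | inj₂ takesΓ = ⊥-elim (ModelOf⇒¬Takes𝐟 model takesΓ)
leaf-sequent-satisfied {Δ = Δ} model Σ-𝐛 N-≢𝐛 (inj₂ (inj₁ takes)) with Anyₚ.++⁻ Δ takes
... | inj₁ takesΔ = Any.map (λ e → subst Designated (sym e) des-b) takesΔ
... | inj₂ takesN = let _ , p∈ , Ip = takes-atoms takesN in ⊥-elim (N-≢𝐛 p∈ Ip)
leaf-sequent-satisfied {Δ = Δ} model Σ-𝐛 N-≢𝐛 (inj₂ (inj₂ takes)) with Anyₚ.++⁻ Δ takes
... | inj₁ takesΔ = Any.map (λ e → subst Designated (sym e) des-t) takesΔ
... | inj₂ takesΣ = let _ , p∈ , Ip = takes-atoms takesΣ in ⊥-elim (𝐛≢𝐭 (trans (sym (Σ-𝐛 p∈)) Ip))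

ME-sound : ME Σ Γ N Δ Θ → Var Γ ⊆ Σ ∪ N ∪ Θ → MinInconsModel Γ I
         → (∀ {p} → p ∈ Σ → I p ≡ 𝐛) → (∀ {p} → p ∈ N → I p ≢ 𝐛) → Any (Models I) Δ
ME-sound {I = I} (m1 {Σ} {Γ} {N} {Δ} {Θ} q r) cov (_ , minimal) Σ-𝐛 N-≢𝐛 with RP-sound r
... | J , ⊭ = ⊥-elim (minimal (smaller-inconsistency J-model below (Σ-𝐛 (here refl)) (J-≢𝐛 q∈)))
  where
  J-model : ModelOf J Γ
  J-model = ¬Takes𝐟⇒ModelOf (⊭ ∘ inj₁)
  J-≢𝐛 : ∀ {p} → p ∈ Θ ++ N ++ [ q ] → J p ≢ 𝐛
  J-≢𝐛 = ¬takes-atoms (⊭ ∘ inj₂ ∘ inj₁)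
  q∈ : q ∈ Θ ++ N ++ [ q ]
  q∈ = xs⊆ys++xs _ Θ (xs⊆ys++xs _ N (here refl))
  below : ∀ {p} → p ∈ Var Γ → J p ≡ 𝐛 → I p ≡ 𝐛
  below p∈ Jp with cov p∈
  ... | inj₁ p∈Σ        = Σ-𝐛 p∈Σ
  ... | inj₂ (inj₁ p∈N) = ⊥-elim (J-≢𝐛 (xs⊆ys++xs _ Θ (xs⊆xs++ys _ _ p∈N)) Jp)
  ... | inj₂ (inj₂ p∈Θ) = ⊥-elim (J-≢𝐛 (xs⊆xs++ys _ _ p∈Θ) Jp)
ME-sound {I = I} (m2 s) _ (model , _) Σ-𝐛 N-≢𝐛 =
  leaf-sequent-satisfied model Σ-𝐛 N-≢𝐛 (SP-sound s I)
ME-sound {I = I} (m3 q d₁ d₂) cov mi Σ-𝐛 N-≢𝐛 with I q ≟𝐛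
... | yes Iq = ME-sound d₁ (move-to-Σ cov) mi (λ { (here refl) → Iq ; (there p∈) → Σ-𝐛 p∈ }) N-≢𝐛
... | no Iq  = ME-sound d₂ (move-to-N cov) mi Σ-𝐛 (λ { (here refl) → Iq ; (there p∈) → N-≢𝐛 p∈ })
ME-sound (sets fΣ fΓ fN fΔ fΘ d) cov mi Σ-𝐛 N-≢𝐛 =
  Any-resp-⊆ (⊆-of fΔ)
    (ME-sound d (cover-sets fΓ fΣ fN fΘ cov) (minInconsModel-sets fΓ mi)
      (Σ-𝐛 ∘ ⊆-of fΣ) (N-≢𝐛 ∘ ⊆-of fN))

-- Completeness of ME

all⊎any : {P Q : A → Set} → (∀ x → P x ⊎ Q x) → ∀ xs → All P xs ⊎ Any Q xs
all⊎any f [] = inj₁ []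
all⊎any f (x ∷ xs) with f x
... | inj₁ px = Sum.map (px ∷_) there (all⊎any f xs)
... | inj₂ qx = inj₂ (here qx)

leaf-sequent-falsified : ¬ I ⊨ atoms Σ ++ Γ ∣ Δ ++ atoms N ∣ Δ ++ atoms Σ
                       → ModelOf I Γ × (∀ {p} → p ∈ Σ → I p ≡ 𝐛) × (∀ {p} → p ∈ N → I p ≢ 𝐛)
                       × ¬ Any (Models I) Δ
leaf-sequent-falsified {I} {Σ} {Γ} {Δ} ⊭ =
  ¬Takes𝐟⇒ModelOf (⊭ ∘ inj₁ ∘ Anyₚ.++⁺ʳ (atoms Σ)) ,
  (λ p∈ → neither-𝐟-nor-𝐭 (¬takes-atoms (⊭ ∘ inj₁ ∘ Anyₚ.++⁺ˡ) p∈)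
                          (¬takes-atoms (⊭ ∘ inj₂ ∘ inj₂ ∘ Anyₚ.++⁺ʳ Δ) p∈)) ,
  ¬takes-atoms (⊭ ∘ inj₂ ∘ inj₁ ∘ Anyₚ.++⁺ʳ Δ) ,
  λ models → let _ , δ∈ , m = find models in undesignated m δ∈
  where
  undesignated : Models I φ → φ ∈ Δ → ⊥
  undesignated m δ∈ with designated-cases m
  ... | inj₁ e = ⊭ (inj₂ (inj₁ (Anyₚ.++⁺ˡ (lose δ∈ e))))
  ... | inj₂ e = ⊭ (inj₂ (inj₂ (Anyₚ.++⁺ˡ (lose δ∈ e))))

-- The restriction is 𝐛 only on Σ. A model of Γ strictly below it is not 𝐛 at some q ∈ Σ,
-- nor anywhere on N, so it falsifies the S-provable sequent Γ ∣ N , q ∣ ∅.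
restrict-minimal : X ⊆ Σ ∪ N ∪ [] → Var Γ ⊆ X → ModelOf I Γ
                 → (∀ {p} → p ∈ Σ → I p ≡ 𝐛) → (∀ {p} → p ∈ N → I p ≢ 𝐛)
                 → (∀ {q} → q ∈ Σ → SP Γ (atoms (N ++ [ q ])) [])
                 → MinInconsModel Γ (restrict X I)
restrict-minimal {X} {Σ} {N} {Γ} {I} cov sub model Σ-𝐛 N-≢𝐛 sp =
  restrict-model sub model , not-smaller
  where
  not-smaller : ¬ (∃ λ J → ModelOf J Γ × InconsStrictSub J (restrict X I))
  not-smaller (J , J-model , below , p , I′p , Jp) with restrict-𝐛 {X} I′p
  ... | p∈X , Ip with cov p∈X
  ... | inj₂ (inj₁ p∈N) = N-≢𝐛 p∈N Ip
  ... | inj₁ p∈Σ with SP-sound (sp p∈Σ) J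
  ...   | inj₁ takesΓ = ModelOf⇒¬Takes𝐟 J-model takesΓ
  ...   | inj₂ (inj₂ ())
  ...   | inj₂ (inj₁ takes) with takes-atoms takes
  ...     | n , n∈ , Jn with Anyₚ.++⁻ N n∈
  ...       | inj₁ n∈N = N-≢𝐛 n∈N (proj₂ (restrict-𝐛 {X} (below n Jn)))
  ...       | inj₂ (here refl) = Jp Jn

leaf-unfalsifiable : Γ ⊨b Δ → Var (Γ ++ Δ) ⊆ Σ ∪ N ∪ []
                   → (∀ {q} → q ∈ Σ → SP Γ (atoms (N ++ [ q ])) [])
                   → ¬ Falsifiable (atoms Σ ++ Γ) (Δ ++ atoms N) (Δ ++ atoms Σ)
leaf-unfalsifiable {Γ} {Δ} ⊨ cov sp (I , ⊭) =
  let model , Σ-𝐛 , N-≢𝐛 , ¬Δ = leaf-sequent-falsified ⊭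
      δ , δ∈ , m = find (⊨ _ (restrict-minimal cov (Var⊆Var-++ˡ Γ Δ) model Σ-𝐛 N-≢𝐛 sp))
  in ¬Δ (lose δ∈ (subst Designated (val-restrict {δ} (Var⊆Var-++ʳ Γ Δ ∘ vars⊆Var δ∈)) m))

ME-leaf : Γ ⊨b Δ → Var (Γ ++ Δ) ⊆ Σ ∪ N ∪ [] → ME Σ Γ N Δ []
ME-leaf {Γ} {Δ} {Σ} {N} ⊨ cov with decide (atoms Σ ++ Γ) (Δ ++ atoms N) (Δ ++ atoms Σ)
... | inj₁ s = m2 s
... | inj₂ r with all⊎any (λ q → decide Γ (atoms (N ++ [ q ])) []) Σ
...   | inj₁ sp = ⊥-elim (leaf-unfalsifiable ⊨ cov (All.lookup sp) (RP-sound r))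
...   | inj₂ rp with find rp
...     | q , q∈ , r′ =
  sets (sameSet-∷ q∈) sameSet-refl sameSet-refl sameSet-refl sameSet-refl (m1 q r′)

ME-complete : Γ ⊨b Δ → ∀ Θ → Var (Γ ++ Δ) ⊆ Σ ∪ N ∪ Θ → ME Σ Γ N Δ Θ
ME-complete ⊨ [] cov = ME-leaf ⊨ cov
ME-complete ⊨ (q ∷ Θ) cov =
  m3 q (ME-complete ⊨ Θ (move-to-Σ cov)) (ME-complete ⊨ Θ (move-to-N cov))

mainTheorem4 : (Γ Δ : List Fm) → (Γ ⊨b Δ) ⇔ ME [] Γ [] Δ (Var (Γ ++ Δ))
mainTheorem4 Γ Δ = mk⇔
  (λ ⊨ → ME-complete ⊨ (Var (Γ ++ Δ)) (inj₂ ∘ inj₂))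
  (λ d I mi → ME-sound d (inj₂ ∘ inj₂ ∘ Var⊆Var-++ˡ Γ Δ) mi (λ ()) (λ ()))
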